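{- There are operations on cut-free derivations: $\mathsf{I}\mathrm{L}^{ -1}$, sending a cut-free derivation of $\mathsf{I} \mid \Gamma \vdash C$ to a cut-free derivation of $- \mid \Gamma \vdash C$, and $\otimes\mathrm{L}^{ -1}$, sending a cut-free derivation of $A \otimes B \mid \Gamma \vdash C$ to a cut-free derivation of $A \mid B, \Gamma \vdash C$. Moreover, both operations are compatible with $\circeq$ (if $f \circeq g$ then $\mathsf I\mathrm L^{ -1} f \circeq \mathsf I\mathrm L^{ -1} g$, and likewise for $\otimes\mathrm L^{ -1}$), and for all cut-free derivations $f$ of the appropriate types: $\mathsf I\mathrm L^{ -1}(\mathsf I\mathrm L\, f) = f$, $\mathsf I\mathrm L(\mathsf I\mathrm L^{ -1} f) \circeq f$, $\otimes\mathrm L^{ -1}(\otimes\mathrm L\, f) = f$, and $\otimes\mathrm L(\otimes\mathrm L^{ -1} f) \circeq f$.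
   Context: Fix a set $\mathrm{Var}$ of atoms. Formulae: atoms $X \in \mathrm{Var}$, $\mathsf{I}$, and $A \otimes B$ for formulae $A, B$. A context is a finite list of formulae; a stoup $S$ is either empty (written $-$) or a single formula. Cut-free skew monoidal sequent calculus: sequents $S \mid \Gamma \vdash C$ derived by (ax) $A \mid\ \vdash A$; (pass) from $A \mid \Gamma \vdash C$ infer $- \mid A, \Gamma \vdash C$; ($\mathsf I$L) from $- \mid \Gamma \vdash C$ infer $\mathsf I \mid \Gamma \vdash C$; ($\mathsf I$R) $- \mid\ \vdash \mathsf I$; ($\otimes$L) from $A \mid B, \Gamma \vdash C$ infer $A \otimes B \mid \Gamma \vdash C$; ($\otimes$R) from $S \mid \Gamma \vdash A$ and $- \mid \Delta \vdash B$ infer $S \mid \Gamma, \Delta \vdash A \otimes B$. The relation $\circeq$ is the least congruence on cut-free derivations (w.r.t. all rules) containing: $\mathrm{ax}_{\mathsf I} \circeq \mathsf{I}\mathrm{L}(\mathsf I\mathrm R)$; $\mathrm{ax}_{A \otimes B} \circeq \otimes\mathrm L(\otimes\mathrm R(\mathrm{ax}_A, \mathrm{pass}(\mathrm{ax}_B)))$; $\otimes\mathrm R(\mathrm{pass}\, f, g) \circeq \mathrm{pass}(\otimes\mathrm R(f, g))$; $\otimes\mathrm R(\mathsf I\mathrm L\, f, g) \circeq \mathsf I\mathrm L(\otimes\mathrm R(f, g))$; $\otimes\mathrm R(\otimes\mathrm L\, f, g) \circeq \otimes\mathrm L(\otimes\mathrm R(f, g))$ (for all $f, g$ of appropriate types).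 -}

module Defs where

open import Data.List using (List; []; _∷_; _++_)
open import Data.Maybe using (Maybe; just; nothing)

module Calc (Var : Set) where

  infixr 30 _⊗_
  data Fma : Set where
    `_  : Var → Fma
    I   : Fma
    _⊗_ : Fma → Fma → Fma

  -- stoup: nothing = empty stoup (-), just A = single formula
  Stp : Set
  Stp = Maybe Fma

  Cxt : Set
  Cxt = List Fma

  infix 15 _∣_⊢_
  data _∣_⊢_ : Stp → Cxt → Fma → Set where
    ax   : ∀ {A} → just A ∣ [] ⊢ A
    pass : ∀ {Γ A C} → just A ∣ Γ ⊢ C → nothing ∣ A ∷ Γ ⊢ C
    IL   : ∀ {Γ C} → nothing ∣ Γ ⊢ C → just I ∣ Γ ⊢ C
    IR   : nothing ∣ [] ⊢ I
    ⊗L   : ∀ {Γ A B C} → just A ∣ B ∷ Γ ⊢ C → just (A ⊗ B) ∣ Γ ⊢ C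
    ⊗R   : ∀ {S Γ Δ A B} → S ∣ Γ ⊢ A → nothing ∣ Δ ⊢ B → S ∣ Γ ++ Δ ⊢ A ⊗ B

  infix 5 _≗_
  data _≗_ : ∀ {S Γ C} → S ∣ Γ ⊢ C → S ∣ Γ ⊢ C → Set where
    refl  : ∀ {S Γ C} {f : S ∣ Γ ⊢ C} → f ≗ f
    ~_    : ∀ {S Γ C} {f g : S ∣ Γ ⊢ C} → f ≗ g → g ≗ f
    _∙_   : ∀ {S Γ C} {f g h : S ∣ Γ ⊢ C} → f ≗ g → g ≗ h → f ≗ h
    pass  : ∀ {Γ A C} {f g : just A ∣ Γ ⊢ C} → f ≗ g → pass f ≗ pass g
    IL    : ∀ {Γ C} {f g : nothing ∣ Γ ⊢ C} → f ≗ g → IL f ≗ IL g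
    ⊗L    : ∀ {Γ A B C} {f g : just A ∣ B ∷ Γ ⊢ C} → f ≗ g → ⊗L f ≗ ⊗L g
    ⊗R    : ∀ {S Γ Δ A B} {f g : S ∣ Γ ⊢ A} {f' g' : nothing ∣ Δ ⊢ B}
            → f ≗ g → f' ≗ g' → ⊗R f f' ≗ ⊗R g g'
    axI   : ax ≗ IL IR
    ax⊗   : ∀ {A B} → ax {A ⊗ B} ≗ ⊗L (⊗R ax (pass ax))
    ⊗Rpass : ∀ {Γ Δ A A' B} {f : just A' ∣ Γ ⊢ A} {g : nothing ∣ Δ ⊢ B}
            → ⊗R (pass f) g ≗ pass (⊗R f g)
    ⊗RIL  : ∀ {Γ Δ A B} {f : nothing ∣ Γ ⊢ A} {g : nothing ∣ Δ ⊢ B}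
            → ⊗R (IL f) g ≗ IL (⊗R f g)
    ⊗R⊗L  : ∀ {Γ Δ A A' B' B} {f : just A' ∣ B' ∷ Γ ⊢ A} {g : nothing ∣ Δ ⊢ B}
            → ⊗R (⊗L f) g ≗ ⊗L (⊗R f g)

-- A derivation whose stoup is I (resp. A ⊗ B) ends in ax, in the left rule
-- IL (resp. ⊗L), or in ⊗R, whose left premise has the same stoup.  The
-- inverses therefore replace ax by its η-expansion, strip the left rule, and
-- recurse into the left premise of ⊗R.  Of the generating equations only
-- those with such a stoup survive, and each becomes an identity.
module Submission where

open import Defs
open import Data.List using (_∷_)
open import Data.Maybe using (just; nothing)
open import Data.Product using (Σ; _×_; _,_)
open import Relation.Binary.PropositionalEquality using (_≡_; refl)

module Inversion (Var : Set) where
  open Calc Var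

  IL⁻¹ : ∀ {Γ C} → just I ∣ Γ ⊢ C → nothing ∣ Γ ⊢ C
  IL⁻¹ ax       = IR
  IL⁻¹ (IL f)   = f
  IL⁻¹ (⊗R f g) = ⊗R (IL⁻¹ f) g

  ⊗L⁻¹ : ∀ {A B Γ C} → just (A ⊗ B) ∣ Γ ⊢ C → just A ∣ B ∷ Γ ⊢ C
  ⊗L⁻¹ ax       = ⊗R ax (pass ax)
  ⊗L⁻¹ (⊗L f)   = f
  ⊗L⁻¹ (⊗R f g) = ⊗R (⊗L⁻¹ f) g

  IL⁻¹-cong : ∀ {Γ C} {f g : just I ∣ Γ ⊢ C} → f ≗ g → IL⁻¹ f ≗ IL⁻¹ g
  IL⁻¹-cong refl     = refl
  IL⁻¹-cong (~ p)    = ~ IL⁻¹-cong p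
  IL⁻¹-cong (p ∙ q)  = IL⁻¹-cong p ∙ IL⁻¹-cong q
  IL⁻¹-cong (IL p)   = p
  IL⁻¹-cong (⊗R p q) = ⊗R (IL⁻¹-cong p) q
  IL⁻¹-cong axI      = refl
  IL⁻¹-cong ⊗RIL     = refl

  ⊗L⁻¹-cong : ∀ {A B Γ C} {f g : just (A ⊗ B) ∣ Γ ⊢ C} → f ≗ g → ⊗L⁻¹ f ≗ ⊗L⁻¹ g
  ⊗L⁻¹-cong refl     = refl
  ⊗L⁻¹-cong (~ p)    = ~ ⊗L⁻¹-cong p
  ⊗L⁻¹-cong (p ∙ q)  = ⊗L⁻¹-cong p ∙ ⊗L⁻¹-cong q
  ⊗L⁻¹-cong (⊗L p)   = p
  ⊗L⁻¹-cong (⊗R p q) = ⊗R (⊗L⁻¹-cong p) q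
  ⊗L⁻¹-cong ax⊗      = refl
  ⊗L⁻¹-cong ⊗R⊗L     = refl

  IL-IL⁻¹ : ∀ {Γ C} (f : just I ∣ Γ ⊢ C) → IL (IL⁻¹ f) ≗ f
  IL-IL⁻¹ ax       = ~ axI
  IL-IL⁻¹ (IL f)   = refl
  IL-IL⁻¹ (⊗R f g) = (~ ⊗RIL) ∙ ⊗R (IL-IL⁻¹ f) refl

  ⊗L-⊗L⁻¹ : ∀ {A B Γ C} (f : just (A ⊗ B) ∣ Γ ⊢ C) → ⊗L (⊗L⁻¹ f) ≗ f
  ⊗L-⊗L⁻¹ ax       = ~ ax⊗
  ⊗L-⊗L⁻¹ (⊗L f)   = refl
  ⊗L-⊗L⁻¹ (⊗R f g) = (~ ⊗R⊗L) ∙ ⊗R (⊗L-⊗L⁻¹ f) refl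

lemma4p6 : (Var : Set) → let open Calc Var in
    Σ (∀ {Γ C} → just I ∣ Γ ⊢ C → nothing ∣ Γ ⊢ C) λ ILinv →
    Σ (∀ {A B Γ C} → just (A ⊗ B) ∣ Γ ⊢ C → just A ∣ B ∷ Γ ⊢ C) λ ⊗Linv →
      (∀ {Γ C} {f g : just I ∣ Γ ⊢ C} → f ≗ g → ILinv f ≗ ILinv g)
      × (∀ {A B Γ C} {f g : just (A ⊗ B) ∣ Γ ⊢ C} → f ≗ g → ⊗Linv f ≗ ⊗Linv g)
      × (∀ {Γ C} (f : nothing ∣ Γ ⊢ C) → ILinv (IL f) ≡ f)
      × (∀ {Γ C} (f : just I ∣ Γ ⊢ C) → IL (ILinv f) ≗ f)
      × (∀ {A B Γ C} (f : just A ∣ B ∷ Γ ⊢ C) → ⊗Linv (⊗L f) ≡ f)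
      × (∀ {A B Γ C} (f : just (A ⊗ B) ∣ Γ ⊢ C) → ⊗L (⊗Linv f) ≗ f)
lemma4p6 Var =
  IL⁻¹ , ⊗L⁻¹ , IL⁻¹-cong , ⊗L⁻¹-cong , (λ _ → refl) , IL-IL⁻¹ , (λ _ → refl) , ⊗L-⊗L⁻¹
  where open Inversion Var
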